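{- Let $n\ge1$, $k_0>0$, and $w,w'\in\{0,1\}^{n+1}$ (indexed by $0,\dots,n$) such that $w(k)=w'(k)$ for all $k>k_0$, $w(k)=w'(k-1)$ for all $0<k\le k_0$, and $w(0)=w'(0)$. Then for every proper $\alpha\in2^\omega$, $s^{H_{n,w}}_\alpha\le_{sW}s^{H_{n,w'}}_\alpha$.
   Context: Cantor space $2^\omega$ carries the lexicographic order $<_{lex}$. For $\alpha\in2^\omega$, $s_\alpha(x)=0$ if $x<_{lex}\alpha$ and $1$ otherwise. A sequence is proper if it contains infinitely many $1$'s. For $v\in\{0,1\}^n$, $t(v)$ is the number of $j$ with $v(j)=1$. For $w\in\{0,1\}^{n+1}$, $H_{n,w}\colon\{0,1\}^n\to\{0,1\}$ is the truth-table $H_{n,w}(v)=w(t(v))$. For a truth-table $G$, $s^G_\alpha(x_1,\dots,x_n)=G(s_\alpha(x_1),\dots,s_\alpha(x_n))$. $f\le_{sW}g$ means there are computable functionals $\Phi,\Psi$ with $f(x)=\Psi(g(\Phi(x)))$ for all $x$. -}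

module Defs where

open import Data.Nat using (ℕ; zero; suc; _<_; _≤_)
open import Data.Fin using (Fin; toℕ; inject₁) renaming (zero to fz; suc to fs)
open import Data.Vec using (Vec; []; _∷_)
open import Data.Bool using (Bool; true; false)
open import Data.Product using (Σ; _×_; ∃)
open import Data.Sum using (_⊎_)
open import Relation.Binary.PropositionalEquality using (_≡_)
open import Relation.Nullary using (¬_)

Cantor : Set
Cantor = ℕ → Bool

b2n : Bool → ℕ
b2n false = 0
b2n true  = 1

_<lex_ : Cantor → Cantor → Set
x <lex α = Σ ℕ λ k → (∀ m → m < k → x m ≡ α m) × (x k ≡ false) × (α k ≡ true)

-- graph of s_α :  SAlpha α x b  means  s_α(x) = b  (false = 0, true = 1)
-- (s_α is not a computable function, so it is given by its graph)
SAlpha : Cantor → Cantor → Bool → Set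
SAlpha α x b = (b ≡ false × x <lex α) ⊎ (b ≡ true × ¬ (x <lex α))

Proper : Cantor → Set
Proper α = ∀ m → Σ ℕ λ k → m ≤ k × α k ≡ true

t : ∀ {n} → (Fin n → Bool) → Fin (suc n)
t {zero}  v = fz
t {suc n} v with v fz
... | true  = fs (t (λ i → v (fs i)))
... | false = inject₁ (t (λ i → v (fs i)))

H : (n : ℕ) → (Fin (suc n) → Bool) → (Fin n → Bool) → Bool
H n w v = w (t v)

data Code : ℕ → Set where
  zer  : ∀ {k} → Code k
  succ : Code 1
  proj : ∀ {k} → Fin k → Code k
  orc  : Code 2
  comp : ∀ {m k} → Code m → Vec (Code k) m → Code k
  prec : ∀ {k} → Code k → Code (suc (suc k)) → Code (suc k)
  mu   : ∀ {k} → Code (suc k) → Code k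

lookupV : ∀ {A : Set} {k} → Vec A k → Fin k → A
lookupV (x ∷ xs) fz     = x
lookupV (x ∷ xs) (fs i) = lookupV xs i

mutual
  data Eval (O : ℕ → ℕ → ℕ) : ∀ {k} → Code k → Vec ℕ k → ℕ → Set where
    e-zer  : ∀ {k} {xs : Vec ℕ k} → Eval O zer xs 0
    e-succ : ∀ {x} → Eval O succ (x ∷ []) (suc x)
    e-proj : ∀ {k} {i : Fin k} {xs} → Eval O (proj i) xs (lookupV xs i)
    e-orc  : ∀ {a b} → Eval O orc (a ∷ b ∷ []) (O a b)
    e-comp : ∀ {m k} {f : Code m} {gs : Vec (Code k) m} {xs ys y} →
             EvalVec O gs xs ys → Eval O f ys y → Eval O (comp f gs) xs y
    e-prec0 : ∀ {k} {f : Code k} {g} {xs y} →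
              Eval O f xs y → Eval O (prec f g) (0 ∷ xs) y
    e-precS : ∀ {k} {f : Code k} {g} {xs n r y} →
              Eval O (prec f g) (n ∷ xs) r → Eval O g (n ∷ r ∷ xs) y →
              Eval O (prec f g) (suc n ∷ xs) y
    e-mu   : ∀ {k} {f : Code (suc k)} {xs y} →
             Eval O f (y ∷ xs) 0 →
             (∀ z → z < y → Σ ℕ λ v → Eval O f (z ∷ xs) (suc v)) →
             Eval O (mu f) xs y

  data EvalVec (O : ℕ → ℕ → ℕ) : ∀ {m k} → Vec (Code k) m → Vec ℕ k → Vec ℕ m → Set where
    ev-[] : ∀ {k} {xs : Vec ℕ k} → EvalVec O [] xs []
    ev-∷  : ∀ {m k} {g : Code k} {gs : Vec (Code k) m} {xs y ys} →
            Eval O g xs y → EvalVec O gs xs ys → EvalVec O (g ∷ gs) xs (y ∷ ys)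

-- oracle presenting a tuple x : (2^ω)^n : query (i , j) gives bit j of x_i
-- (0 if i ≥ n)
query : ∀ {n} → (Fin n → Cantor) → ℕ → ℕ → ℕ
query {zero}  x i       j = 0
query {suc n} x zero    j = b2n (x fz j)
query {suc n} x (suc i) j = query (λ l → x (fs l)) i j

Computable : ∀ {n m} → ((Fin n → Cantor) → (Fin m → Cantor)) → Set
Computable {n} {m} Φ =
  Σ (Code 2) λ e → ∀ (x : Fin n → Cantor) (i : Fin m) (j : ℕ) →
    Eval (query x) e (toℕ i ∷ j ∷ []) (b2n (Φ x i j))

SG : ∀ {n} → Cantor → ((Fin n → Bool) → Bool) → (Fin n → Cantor) → Bool → Set
SG α G x b = Σ (_ → Bool) λ u → (∀ i → SAlpha α (x i) (u i)) × (G u ≡ b)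

-- s^G_α ≤_sW s^G'_α : computable Φ, Ψ with s^G_α(x) = Ψ(s^G'_α(Φ(x))).
-- The output space {0,1} is discrete, so every Ψ : Bool → Bool is computable.
_≤sW_via_ : ∀ {n} → ((Fin n → Bool) → Bool) → ((Fin n → Bool) → Bool) → Cantor → Set
_≤sW_via_ {n} G G' α =
  Σ ((Fin n → Cantor) → (Fin n → Cantor)) λ Φ → Computable Φ ×
  Σ (Bool → Bool) λ Ψ →
    ∀ (x : Fin n → Cantor) (b b' : Bool) →
      SG α G x b → SG α G' (Φ x) b' → b ≡ Ψ b'

{-# OPTIONS --safe #-}
-- Let T be the number of inputs x i with s_α (x i) = 1. The lexicographic min and max of two
-- sequences are computable (prefixes are compared by a three-state automaton), and s_α commutes
-- with them: each agrees on every prefix with one of its arguments, and lies lexicographically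
-- below (above) both. So the "m-th largest of the x i", a lattice polynomial in them, is computable
-- and s_α sends it to [m ≤ T]. Output p of the reduction is this order statistic for the cutoff
-- m = p + 1 + [p < k₀]; then exactly T - 1 outputs are 1 if 1 ≤ T ≤ k₀, and exactly T otherwise,
-- which is the change of count under which the hypotheses make H n w and H n w′ agree.
-- Properness of α is used only for 0^ω <lex α.
module Submission where

open import Defs
open import Data.Nat using (ℕ; zero; suc; _+_; _<_; _≤_; _⊔_; _≤ᵇ_; _<ᵇ_; z≤n; s≤s)
open import Data.Nat.Properties
  using ( ≤-refl; <⇒≤; <-≤-trans; m≤n⇒m≤1+n; m<n⇒m<1+n; m<1+n⇒m<n∨m≡n; m≤m⊔n; m≤n⊔m
        ; <-cmp; ≮⇒≥; ≰⇒>; _<?_; _≤?_)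
open import Data.Fin using (Fin; toℕ; inject₁) renaming (zero to fz; suc to fs)
open import Data.Fin.Properties using (toℕ-injective; toℕ-inject₁; toℕ<n; toℕ≤pred[n])
open import Data.Vec using (Vec; []; _∷_)
open import Data.Bool using (Bool; true; false; _∧_; _∨_; if_then_else_)
open import Data.Bool.Properties using (if-eta; ∨-identityʳ; ∨-zeroʳ)
open import Data.Product using (_×_; _,_; proj₂)
open import Data.Sum using (_⊎_; inj₁; inj₂; [_,_])
import Data.Sum as Sum
open import Data.Empty using (⊥-elim)
open import Function using (_∘_; id)
open import Relation.Binary.Definitions using (tri<; tri≈; tri>)
open import Relation.Nullary using (¬_; yes; no)
open import Relation.Binary.PropositionalEquality
  using (_≡_; _≢_; refl; sym; trans; cong; cong₂; subst; module ≡-Reasoning)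
open ≡-Reasoning

Agree : Cantor → Cantor → ℕ → Set
Agree x y k = ∀ m → m < k → x m ≡ y m

LexAt : Cantor → Cantor → ℕ → Set
LexAt x y d = Agree x y d × x d ≡ false × y d ≡ true

_≤lex_ : Cantor → Cantor → Set
x ≤lex y = ¬ (y <lex x)

agree-sym : ∀ {x y k} → Agree x y k → Agree y x k
agree-sym p m m<k = sym (p m m<k)

agree-≤ : ∀ {x y j k} → j ≤ k → Agree x y k → Agree x y j
agree-≤ j≤k p m m<j = p m (<-≤-trans m<j j≤k)

agree-snoc : ∀ {x y k} → Agree x y k → x k ≡ y k → Agree x y (suc k)
agree-snoc p e m m<1+k with m<1+n⇒m<n∨m≡n m<1+k
... | inj₁ m<k  = p m m<k
... | inj₂ refl = e

agree-trans : ∀ {x y z k} → Agree x y k → Agree y z k → Agree x z k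
agree-trans p q m m<k = trans (p m m<k) (q m m<k)

LexAt-respˡ : ∀ {x x′ y d} → Agree x x′ (suc d) → LexAt x y d → LexAt x′ y d
LexAt-respˡ p (a , xd , yd) =
  agree-trans (agree-sym (agree-≤ (m≤n⇒m≤1+n ≤-refl) p)) a , trans (sym (p _ ≤-refl)) xd , yd

LexAt-respʳ : ∀ {x y y′ d} → Agree y y′ (suc d) → LexAt x y d → LexAt x y′ d
LexAt-respʳ p (a , xd , yd) =
  agree-trans a (agree-≤ (m≤n⇒m≤1+n ≤-refl) p) , xd , trans (sym (p _ ≤-refl)) yd

LexAt-irrefl : ∀ {x d} → ¬ LexAt x x d
LexAt-irrefl (_ , xd , xd′) with trans (sym xd) xd′
... | ()

agree⇒¬LexAt : ∀ {x y d k} → d < k → Agree x y k → ¬ LexAt x y d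
agree⇒¬LexAt d<k a l = LexAt-irrefl (LexAt-respʳ (agree-sym (agree-≤ d<k a)) l)

<lex-trans : ∀ {x y z} → x <lex y → y <lex z → x <lex z
<lex-trans {x} {y} {z} (d , xy , xd , yd) (e , yz , ye , ze) with <-cmp d e
... | tri< d<e _ _ = d , agree-trans xy (agree-≤ (<⇒≤ d<e) yz) , xd , trans (sym (yz d d<e)) yd
... | tri> _ _ e<d = e , agree-trans (agree-≤ (<⇒≤ e<d) xy) yz , trans (xy e e<d) ye , ze
... | tri≈ _ refl _ with trans (sym ye) yd
...   | ()

<lex-irrefl : ∀ {x} → ¬ x <lex x
<lex-irrefl (d , l) = LexAt-irrefl l

data Comparison : Set where
  lt eq gt : Comparison

lt≢gt : lt ≢ gt
lt≢gt ()

eq≢gt : eq ≢ gt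
eq≢gt ()

isGt : Comparison → Bool
isGt gt = true
isGt _  = false

compareBits : Bool → Bool → Comparison
compareBits false true  = lt
compareBits true  false = gt
compareBits false false = eq
compareBits true  true  = eq

compareStep : Comparison → Bool → Bool → Comparison
compareStep eq a b = compareBits a b
compareStep c  _ _ = c

compare : Cantor → Cantor → ℕ → Comparison
compare x y zero    = eq
compare x y (suc k) = compareStep (compare x y k) (x k) (y k)

data PrefixOrder (x y : Cantor) (k : ℕ) : Comparison → Set where
  agree   : Agree x y k → PrefixOrder x y k eq
  less    : ∀ {d} → d < k → LexAt x y d → PrefixOrder x y k lt
  greater : ∀ {d} → d < k → LexAt y x d → PrefixOrder x y k gt

prefixOrder-step : ∀ {x y k c} → PrefixOrder x y k c →
                   PrefixOrder x y (suc k) (compareStep c (x k) (y k))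
prefixOrder-step {x} {y} {k} (agree a) with x k in xk | y k in yk
... | false | true  = less ≤-refl (a , xk , yk)
... | true  | false = greater ≤-refl (agree-sym a , yk , xk)
... | false | false = agree (agree-snoc a (trans xk (sym yk)))
... | true  | true  = agree (agree-snoc a (trans xk (sym yk)))
prefixOrder-step (less d<k l)    = less (m<n⇒m<1+n d<k) l
prefixOrder-step (greater d<k l) = greater (m<n⇒m<1+n d<k) l

compare-sound : ∀ x y k → PrefixOrder x y k (compare x y k)
compare-sound x y zero    = agree λ _ ()
compare-sound x y (suc k) = prefixOrder-step (compare-sound x y k)

prefixOrder-unique : ∀ {x y k c c′} → PrefixOrder x y k c → PrefixOrder x y k c′ → c ≡ c′
prefixOrder-unique (agree _)       (agree _)       = refl
prefixOrder-unique (less _ _)      (less _ _)      = refl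
prefixOrder-unique (greater _ _)   (greater _ _)   = refl
prefixOrder-unique (agree a)       (less d<k l)    = ⊥-elim (agree⇒¬LexAt d<k a l)
prefixOrder-unique (agree a)       (greater d<k l) = ⊥-elim (agree⇒¬LexAt d<k (agree-sym a) l)
prefixOrder-unique (less d<k l)    (agree a)       = ⊥-elim (agree⇒¬LexAt d<k a l)
prefixOrder-unique (greater d<k l) (agree a)       = ⊥-elim (agree⇒¬LexAt d<k (agree-sym a) l)
prefixOrder-unique (less _ l)      (greater _ l′)  = ⊥-elim (<lex-irrefl (<lex-trans (_ , l) (_ , l′)))
prefixOrder-unique (greater _ l)   (less _ l′)     = ⊥-elim (<lex-irrefl (<lex-trans (_ , l) (_ , l′)))

compare-complete : ∀ {x y k c} → PrefixOrder x y k c → compare x y k ≡ c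
compare-complete {x} {y} {k} = prefixOrder-unique (compare-sound x y k)

compare-gt-persists : ∀ {x y j k} → j ≤ k → compare x y j ≡ gt → compare x y k ≡ gt
compare-gt-persists {x} {y} {j} j≤k e with subst (PrefixOrder x y j) e (compare-sound x y j)
... | greater d<j l = compare-complete (greater (<-≤-trans d<j j≤k) l)

lexSelect : Cantor → Cantor → Cantor → Cantor → Cantor
lexSelect x y u v j = if isGt (compare x y (suc j)) then u j else v j

minLex maxLex : Cantor → Cantor → Cantor
minLex x y = lexSelect x y y x
maxLex x y = lexSelect x y x y

module _ {x y u v : Cantor} where

  lexSelect-gt : ∀ {j} → compare x y (suc j) ≡ gt → lexSelect x y u v j ≡ u j
  lexSelect-gt {j} e = cong (λ c → if isGt c then u j else v j) e

  lexSelect-≢gt : ∀ {j} → compare x y (suc j) ≢ gt → lexSelect x y u v j ≡ v j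
  lexSelect-≢gt {j} ne with compare x y (suc j)
  ... | lt = refl
  ... | eq = refl
  ... | gt = ⊥-elim (ne refl)

  lexSelect-agree-u : (∀ j → x j ≡ y j → u j ≡ v j) → ∀ {k} → compare x y k ≡ gt →
                      Agree (lexSelect x y u v) u k
  lexSelect-agree-u uv {k} e = from-order (subst (PrefixOrder x y k) e (compare-sound x y k))
    where
    from-order : PrefixOrder x y k gt → Agree (lexSelect x y u v) u k
    from-order (greater {d} d<k l@(a , _)) j j<k with j <? d
    ... | yes j<d = trans (cong (if _ then u j else_) (sym (uv j (sym (a j j<d))))) (if-eta _)
    ... | no j≮d  = lexSelect-gt (compare-complete (greater (s≤s (≮⇒≥ j≮d)) l))

  lexSelect-agree-v : ∀ {k} → compare x y k ≢ gt → Agree (lexSelect x y u v) v k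
  lexSelect-agree-v ne j j<k = lexSelect-≢gt (ne ∘ compare-gt-persists j<k)

  lexSelect-prefix : (∀ j → x j ≡ y j → u j ≡ v j) → ∀ k →
    compare x y k ≡ gt × Agree (lexSelect x y u v) u k ⊎
    compare x y k ≢ gt × Agree (lexSelect x y u v) v k
  lexSelect-prefix uv k with compare x y k in e
  ... | gt = inj₁ (refl , lexSelect-agree-u uv e)
  ... | lt = inj₂ (lt≢gt , lexSelect-agree-v (lt≢gt ∘ trans (sym e)))
  ... | eq = inj₂ (eq≢gt , lexSelect-agree-v (eq≢gt ∘ trans (sym e)))

module _ {x y : Cantor} where

  minLex-≤lexˡ : minLex x y ≤lex x
  minLex-≤lexˡ (d , l) with lexSelect-prefix {x} {y} (λ _ → sym) (suc d)
  ... | inj₁ (g , a) = lt≢gt (trans (sym (compare-complete (less ≤-refl (LexAt-respʳ a l)))) g)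
  ... | inj₂ (_ , a) = LexAt-irrefl (LexAt-respʳ a l)

  minLex-≤lexʳ : minLex x y ≤lex y
  minLex-≤lexʳ (d , l) with lexSelect-prefix {x} {y} (λ _ → sym) (suc d)
  ... | inj₁ (_ , a)  = LexAt-irrefl (LexAt-respʳ a l)
  ... | inj₂ (ng , a) = ng (compare-complete (greater ≤-refl (LexAt-respʳ a l)))

  ≤lex-maxLexˡ : x ≤lex maxLex x y
  ≤lex-maxLexˡ (d , l) with lexSelect-prefix {x} {y} (λ _ e → e) (suc d)
  ... | inj₁ (_ , a)  = LexAt-irrefl (LexAt-respˡ a l)
  ... | inj₂ (ng , a) = ng (compare-complete (greater ≤-refl (LexAt-respˡ a l)))

  ≤lex-maxLexʳ : y ≤lex maxLex x y
  ≤lex-maxLexʳ (d , l) with lexSelect-prefix {x} {y} (λ _ e → e) (suc d)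
  ... | inj₁ (g , a) = lt≢gt (trans (sym (compare-complete (less ≤-refl (LexAt-respˡ a l)))) g)
  ... | inj₂ (_ , a) = LexAt-irrefl (LexAt-respˡ a l)

≤lex-<lex-trans : ∀ {x y z} → x ≤lex y → y <lex z → x <lex z
≤lex-<lex-trans {x} {y} x≤y (k , l) with compare y x (suc k) | compare-sound y x (suc k)
... | eq | agree a       = k , LexAt-respˡ a l
... | lt | less _ y<x    = ⊥-elim (x≤y (_ , y<x))
... | gt | greater _ x<y = <lex-trans (_ , x<y) (k , l)

Interleaves : Cantor → Cantor → Cantor → Set
Interleaves z x y = ∀ k → Agree z x k ⊎ Agree z y k

lexSelect-interleaves : ∀ {x y u v} → (∀ j → x j ≡ y j → u j ≡ v j) →
                        Interleaves (lexSelect x y u v) u v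
lexSelect-interleaves uv k = Sum.map proj₂ proj₂ (lexSelect-prefix uv k)

module _ {z x y α : Cantor} (i : Interleaves z x y) where

  interleaves-<lex : z <lex α → x <lex α ⊎ y <lex α
  interleaves-<lex (k , l) = Sum.map transfer transfer (i (suc k))
    where
    transfer : ∀ {w} → Agree z w (suc k) → w <lex α
    transfer a = k , LexAt-respˡ a l

  interleaves-<lex-both : x <lex α → y <lex α → z <lex α
  interleaves-<lex-both (kx , lx) (ky , ly) with i (suc (kx ⊔ ky))
  ... | inj₁ a = kx , LexAt-respˡ (agree-sym (agree-≤ (s≤s (m≤m⊔n kx ky)) a)) lx
  ... | inj₂ a = ky , LexAt-respˡ (agree-sym (agree-≤ (s≤s (m≤n⊔m kx ky)) a)) ly

ones zeros : Cantor
ones _  = true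
zeros _ = false

zeros-<lex : ∀ {α} k → α k ≡ true → zeros <lex α
zeros-<lex zero αk = 0 , (λ _ ()) , refl , αk
zeros-<lex {α} (suc k) αk with α 0 in α0
... | true  = 0 , (λ _ ()) , refl , α0
... | false with zeros-<lex {α ∘ suc} k αk
...   | d , a , z , αd = suc d , shift , z , αd
  where
  shift : Agree zeros α (suc d)
  shift zero    _         = sym α0
  shift (suc m) (s≤s m<d) = a m m<d

module _ {α : Cantor} where

  SAlpha-functional : ∀ {x a b} → SAlpha α x a → SAlpha α x b → a ≡ b
  SAlpha-functional (inj₁ (refl , _))   (inj₁ (refl , _))   = refl
  SAlpha-functional (inj₂ (refl , _))   (inj₂ (refl , _))   = refl
  SAlpha-functional (inj₁ (_ , x<α))    (inj₂ (_ , x≮α))    = ⊥-elim (x≮α x<α)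
  SAlpha-functional (inj₂ (_ , x≮α))    (inj₁ (_ , x<α))    = ⊥-elim (x≮α x<α)

  SAlpha-ones : SAlpha α ones true
  SAlpha-ones = inj₂ (refl , λ { (_ , _ , () , _) })

  SAlpha-zeros : Proper α → SAlpha α zeros false
  SAlpha-zeros proper = inj₁ (refl , zeros-<lex _ (proj₂ (proj₂ (proper 0))))

  SAlpha-minLex : ∀ {x y a b} → SAlpha α x a → SAlpha α y b → SAlpha α (minLex x y) (a ∧ b)
  SAlpha-minLex (inj₁ (refl , x<α)) _                   = inj₁ (refl , ≤lex-<lex-trans minLex-≤lexˡ x<α)
  SAlpha-minLex (inj₂ (refl , _))   (inj₁ (refl , y<α)) = inj₁ (refl , ≤lex-<lex-trans minLex-≤lexʳ y<α)
  SAlpha-minLex (inj₂ (refl , x≮α)) (inj₂ (refl , y≮α)) =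
    inj₂ (refl , [ y≮α , x≮α ] ∘ interleaves-<lex (lexSelect-interleaves (λ _ → sym)))

  SAlpha-maxLex : ∀ {x y a b} → SAlpha α x a → SAlpha α y b → SAlpha α (maxLex x y) (a ∨ b)
  SAlpha-maxLex (inj₁ (refl , x<α)) (inj₁ (refl , y<α)) =
    inj₁ (refl , interleaves-<lex-both (lexSelect-interleaves (λ _ e → e)) x<α y<α)
  SAlpha-maxLex (inj₂ (refl , x≮α)) _                   = inj₂ (refl , x≮α ∘ ≤lex-<lex-trans ≤lex-maxLexˡ)
  SAlpha-maxLex (inj₁ (refl , _))   (inj₂ (refl , y≮α)) = inj₂ (refl , y≮α ∘ ≤lex-<lex-trans ≤lex-maxLexʳ)

record LatticeOps (A : Set) : Set where
  field
    top bottom : A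
    join meet  : A → A → A

open LatticeOps

-- The m-th largest of the x i; on Bool, whether at least m of them are true.
atLeast : ∀ {A} → LatticeOps A → ∀ {n} → (Fin n → A) → ℕ → A
atLeast L         x zero    = top L
atLeast L {zero}  x (suc m) = bottom L
atLeast L {suc n} x (suc m) =
  join L (atLeast L (x ∘ fs) (suc m)) (meet L (x fz) (atLeast L (x ∘ fs) m))

record Compatible {A B : Set} (R : A → B → Set) (L : LatticeOps A) (M : LatticeOps B) : Set where
  field
    top-compatible    : R (top L) (top M)
    bottom-compatible : R (bottom L) (bottom M)
    join-compatible   : ∀ {a a′ b b′} → R a b → R a′ b′ → R (join L a a′) (join M b b′)
    meet-compatible   : ∀ {a a′ b b′} → R a b → R a′ b′ → R (meet L a a′) (meet M b b′)

module _ {A B : Set} {R : A → B → Set} {L : LatticeOps A} {M : LatticeOps B} (c : Compatible R L M) where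
  open Compatible c

  atLeast-compatible : ∀ {n} {x : Fin n → A} {y : Fin n → B} → (∀ i → R (x i) (y i)) →
                       ∀ m → R (atLeast L x m) (atLeast M y m)
  atLeast-compatible         r zero    = top-compatible
  atLeast-compatible {zero}  r (suc m) = bottom-compatible
  atLeast-compatible {suc n} r (suc m) =
    join-compatible (atLeast-compatible (r ∘ fs) (suc m))
                    (meet-compatible (r fz) (atLeast-compatible (r ∘ fs) m))

boolOps : LatticeOps Bool
boolOps = record { top = true ; bottom = false ; join = _∨_ ; meet = _∧_ }

lexOps : LatticeOps Cantor
lexOps = record { top = ones ; bottom = zeros ; join = maxLex ; meet = minLex }

SAlpha-compatible : ∀ {α} → Proper α → Compatible (SAlpha α) lexOps boolOps
SAlpha-compatible proper = record
  { top-compatible    = SAlpha-ones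
  ; bottom-compatible = SAlpha-zeros proper
  ; join-compatible   = SAlpha-maxLex
  ; meet-compatible   = SAlpha-minLex
  }

Computes : (ℕ → ℕ → ℕ) → Code 1 → Cantor → Set
Computes O e z = ∀ j → Eval O e (j ∷ []) (b2n (z j))

const : ∀ {k} → ℕ → Code k
const zero    = zer
const (suc l) = comp succ (const l ∷ [])

infixr 9 _·_
_·_ : ∀ {k} → Code 1 → Code k → Code k
f · g = comp f (g ∷ [])

ifC : ∀ {k} → Code k → Code k → Code k → Code k
ifC c t e = comp (prec (proj fz) (proj (fs (fs (fs fz))))) (c ∷ e ∷ t ∷ [])

enc : Comparison → ℕ
enc eq = 0
enc lt = 1
enc gt = 2

caseC : ∀ {k} → Code k → Code k → Code k → Code k → Code k
caseC s a b c =
  comp (prec (proj fz) (prec (proj (fs (fs fz))) (proj (fs (fs (fs (fs (fs fz))))))))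
       (s ∷ a ∷ b ∷ c ∷ [])

module _ {O : ℕ → ℕ → ℕ} {k} {xs : Vec ℕ k} where

  eval-const : ∀ l → Eval O (const l) xs l
  eval-const zero    = e-zer
  eval-const (suc l) = e-comp (ev-∷ (eval-const l) ev-[]) e-succ

  eval-if : ∀ {c t e : Code k} {b} (f : Bool → ℕ) →
            Eval O c xs (b2n b) → Eval O t xs (f true) → Eval O e xs (f false) →
            Eval O (ifC c t e) xs (f b)
  eval-if {b = false} f ec et ee = e-comp (ev-∷ ec (ev-∷ ee (ev-∷ et ev-[]))) (e-prec0 e-proj)
  eval-if {b = true}  f ec et ee = e-comp (ev-∷ ec (ev-∷ ee (ev-∷ et ev-[]))) (e-precS (e-prec0 e-proj) e-proj)

  eval-case : ∀ {s a b d : Code k} {c} (f : Comparison → ℕ) →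
              Eval O s xs (enc c) → Eval O a xs (f eq) → Eval O b xs (f lt) → Eval O d xs (f gt) →
              Eval O (caseC s a b d) xs (f c)
  eval-case {c = eq} f es ea eb ed =
    e-comp (ev-∷ es (ev-∷ ea (ev-∷ eb (ev-∷ ed ev-[])))) (e-prec0 e-proj)
  eval-case {c = lt} f es ea eb ed =
    e-comp (ev-∷ es (ev-∷ ea (ev-∷ eb (ev-∷ ed ev-[])))) (e-precS (e-prec0 e-proj) (e-prec0 e-proj))
  eval-case {c = gt} f es ea eb ed =
    e-comp (ev-∷ es (ev-∷ ea (ev-∷ eb (ev-∷ ed ev-[]))))
           (e-precS (e-precS (e-prec0 e-proj) (e-prec0 e-proj)) (e-precS (e-prec0 e-proj) e-proj))

compareC : Code 1 → Code 1 → Code 1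
compareC X Y = prec (const (enc eq)) (caseC (proj (fs fz)) bits (const (enc lt)) (const (enc gt)))
  where
  bits : Code 2
  bits = ifC (X · proj fz) (ifC (Y · proj fz) (const (enc eq)) (const (enc gt)))
                           (ifC (Y · proj fz) (const (enc lt)) (const (enc eq)))

lexSelectC : Code 1 → Code 1 → Code 1 → Code 1 → Code 1
lexSelectC X Y U V = caseC (compareC X Y · succ · proj fz) V V U

module _ {O : ℕ → ℕ → ℕ} {X Y : Code 1} {x y : Cantor} (hX : Computes O X x) (hY : Computes O Y y) where

  eval-compare : ∀ k → Eval O (compareC X Y) (k ∷ []) (enc (compare x y k))
  eval-compare zero    = e-prec0 e-zer
  eval-compare (suc k) =
    e-precS (eval-compare k)
      (eval-case (λ c → enc (compareStep c (x k) (y k))) e-proj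
        (eval-if (λ a → enc (compareBits a (y k))) (at hX)
          (eval-if (λ b → enc (compareBits true b)) (at hY) (eval-const _) (eval-const _))
          (eval-if (λ b → enc (compareBits false b)) (at hY) (eval-const _) (eval-const _)))
        (eval-const _) (eval-const _))
    where
    at : ∀ {Z z r} → Computes O Z z → Eval O (Z · proj fz) (k ∷ r ∷ []) (b2n (z k))
    at hZ = e-comp (ev-∷ e-proj ev-[]) (hZ k)

  lexSelect-computes : ∀ {U V u v} → Computes O U u → Computes O V v →
                       Computes O (lexSelectC X Y U V) (lexSelect x y u v)
  lexSelect-computes {u = u} {v} hU hV j =
    eval-case (λ c → b2n (if isGt c then u j else v j))
      (e-comp (ev-∷ (e-comp (ev-∷ e-proj ev-[]) e-succ) ev-[]) (eval-compare (suc j)))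
      (hV j) (hV j) (hU j)

codeOps : LatticeOps (Code 1)
codeOps = record
  { top    = const 1
  ; bottom = const 0
  ; join   = λ X Y → lexSelectC X Y X Y
  ; meet   = λ X Y → lexSelectC X Y Y X
  }

Computes-compatible : ∀ {O} → Compatible (Computes O) codeOps lexOps
Computes-compatible = record
  { top-compatible    = λ _ → eval-const 1
  ; bottom-compatible = λ _ → eval-const 0
  ; join-compatible   = λ hX hY → lexSelect-computes hX hY hX hY
  ; meet-compatible   = λ hX hY → lexSelect-computes hX hY hY hX
  }

column : ℕ → Code 1
column i = comp orc (const i ∷ proj fz ∷ [])

column-computes : ∀ {n} (x : Fin n → Cantor) (i : Fin n) → Computes (query x) (column (toℕ i)) (x i)
column-computes x i j =
  subst (Eval _ _ _) (query-toℕ x i) (e-comp (ev-∷ (eval-const _) (ev-∷ e-proj ev-[])) e-orc)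
  where
  query-toℕ : ∀ {n} (x : Fin n → Cantor) (i : Fin n) → query x (toℕ i) j ≡ b2n (x i j)
  query-toℕ x fz     = refl
  query-toℕ x (fs i) = query-toℕ (x ∘ fs) i

-- Recursion on i serves only as a case split: the step ignores the recursive value.
dispatchC : (ℕ → Code 1) → ℕ → Code 2
dispatchC c zero    = c 0 · proj (fs fz)
dispatchC c (suc L) = prec (c 0) (comp (dispatchC (c ∘ suc) L) (proj fz ∷ proj (fs (fs fz)) ∷ []))

eval-dispatch : ∀ {O} {c : ℕ → Code 1} (F : ℕ → ℕ → ℕ) → (∀ p j → Eval O (c p) (j ∷ []) (F p j)) →
                ∀ L {i} j → i ≤ L → Eval O (dispatchC c L) (i ∷ j ∷ []) (F i j)
eval-dispatch F h zero    j z≤n = e-comp (ev-∷ e-proj ev-[]) (h 0 j)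
eval-dispatch F h (suc L) j z≤n = e-prec0 (h 0 j)
eval-dispatch F h (suc L) j (s≤s i≤L) =
  e-precS (eval-dispatch F h (suc L) j (m≤n⇒m≤1+n i≤L))
          (e-comp (ev-∷ e-proj (ev-∷ e-proj ev-[])) (eval-dispatch (F ∘ suc) (h ∘ suc) L j i≤L))

count : ∀ {n} → (Fin n → Bool) → ℕ
count {zero}  v = 0
count {suc n} v = b2n (v fz) + count (v ∘ fs)

toℕ-t : ∀ {n} (v : Fin n → Bool) → toℕ (t v) ≡ count v
toℕ-t {zero}  v = refl
toℕ-t {suc n} v with v fz
... | true  = cong suc (toℕ-t (v ∘ fs))
... | false = trans (toℕ-inject₁ _) (toℕ-t (v ∘ fs))

count≤n : ∀ {n} (v : Fin n → Bool) → count v ≤ n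
count≤n {n} v = subst (_≤ n) (toℕ-t v) (toℕ≤pred[n] (t v))

count-cong : ∀ {n} {u v : Fin n → Bool} → (∀ i → u i ≡ v i) → count u ≡ count v
count-cong {zero}  e = refl
count-cong {suc n} e = cong₂ (λ a c → b2n a + c) (e fz) (count-cong (e ∘ fs))

count-false : ∀ n → count {n} (λ _ → false) ≡ 0
count-false zero    = refl
count-false (suc n) = count-false n

1+m≤ᵇ1+n : ∀ m n → (suc m ≤ᵇ suc n) ≡ (m ≤ᵇ n)
1+m≤ᵇ1+n zero    n = refl
1+m≤ᵇ1+n (suc m) n = refl

≤ᵇ-absorb : ∀ m n → (suc m ≤ᵇ n) ∨ (m ≤ᵇ n) ≡ (m ≤ᵇ n)
≤ᵇ-absorb zero    n       = ∨-zeroʳ _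
≤ᵇ-absorb (suc m) zero    = refl
≤ᵇ-absorb (suc m) (suc n) = begin
  (suc m ≤ᵇ n) ∨ (suc m ≤ᵇ suc n) ≡⟨ cong ((suc m ≤ᵇ n) ∨_) (1+m≤ᵇ1+n m n) ⟩
  (suc m ≤ᵇ n) ∨ (m ≤ᵇ n)         ≡⟨ ≤ᵇ-absorb m n ⟩
  m ≤ᵇ n                          ≡⟨ 1+m≤ᵇ1+n m n ⟨
  suc m ≤ᵇ suc n                  ∎

atLeast-bool : ∀ {n} (u : Fin n → Bool) m → atLeast boolOps u m ≡ (m ≤ᵇ count u)
atLeast-bool         u zero    = refl
atLeast-bool {zero}  u (suc m) = refl
atLeast-bool {suc n} u (suc m) with u fz
... | false = trans (∨-identityʳ _) (atLeast-bool (u ∘ fs) (suc m))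
... | true  = begin
  atLeast boolOps (u ∘ fs) (suc m) ∨ atLeast boolOps (u ∘ fs) m
    ≡⟨ cong₂ _∨_ (atLeast-bool (u ∘ fs) (suc m)) (atLeast-bool (u ∘ fs) m) ⟩
  (suc m ≤ᵇ count (u ∘ fs)) ∨ (m ≤ᵇ count (u ∘ fs))
    ≡⟨ ≤ᵇ-absorb m _ ⟩
  m ≤ᵇ count (u ∘ fs)
    ≡⟨ 1+m≤ᵇ1+n m _ ⟨
  suc m ≤ᵇ suc (count (u ∘ fs))
    ∎

cutoff : ℕ → ℕ → ℕ
cutoff k p = suc (p + b2n (p <ᵇ k))

lowerUpTo : ℕ → ℕ → ℕ
lowerUpTo k       zero          = zero
lowerUpTo zero    (suc T)       = suc T
lowerUpTo (suc k) (suc zero)    = zero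
lowerUpTo (suc k) (suc (suc T)) = suc (lowerUpTo k (suc T))

lowerUpTo-zero : ∀ T → lowerUpTo 0 T ≡ T
lowerUpTo-zero zero    = refl
lowerUpTo-zero (suc T) = refl

lowerUpTo-below : ∀ {k t} → suc t ≤ k → lowerUpTo k (suc t) ≡ t
lowerUpTo-below {suc k} {zero}  _         = refl
lowerUpTo-below {suc k} {suc t} (s≤s t<k) = cong suc (lowerUpTo-below t<k)

lowerUpTo-above : ∀ {k T} → k < T → lowerUpTo k T ≡ T
lowerUpTo-above {zero}  {suc T}       _         = refl
lowerUpTo-above {suc k} {suc (suc T)} (s≤s k<T) = cong suc (lowerUpTo-above k<T)

count-cutoffs : ∀ n k T → T ≤ n → count {n} (λ p → cutoff k (toℕ p) ≤ᵇ T) ≡ lowerUpTo k T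
count-cutoffs n       k       zero          _         = count-false n
count-cutoffs (suc n) zero    (suc T)       (s≤s T≤n) =
  cong suc (trans (count-cutoffs n 0 T T≤n) (lowerUpTo-zero T))
count-cutoffs (suc n) (suc k) (suc zero)    (s≤s T≤n) = count-cutoffs n k 0 T≤n
count-cutoffs (suc n) (suc k) (suc (suc T)) (s≤s T≤n) = cong suc (count-cutoffs n k (suc T) T≤n)

module _ {n k₀ : ℕ} (w w′ : Fin (suc n) → Bool)
         (above : ∀ k → k₀ < toℕ k → w k ≡ w′ k)
         (shifted : ∀ j → toℕ (fs j) ≤ k₀ → w (fs j) ≡ w′ (inject₁ j))
         (at-zero : w fz ≡ w′ fz) where

  weights-match : ∀ a a′ → toℕ a′ ≡ lowerUpTo k₀ (toℕ a) → w a ≡ w′ a′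
  weights-match fz a′ e = trans at-zero (cong w′ (toℕ-injective (sym e)))
  weights-match (fs j) a′ e with suc (toℕ j) ≤? k₀
  ... | yes j<k₀ = trans (shifted j j<k₀)
                     (cong w′ (toℕ-injective (trans (toℕ-inject₁ j) (sym (trans e (lowerUpTo-below j<k₀))))))
  ... | no j≮k₀  = trans (above (fs j) (≰⇒> j≮k₀))
                     (cong w′ (toℕ-injective (sym (trans e (lowerUpTo-above (≰⇒> j≮k₀))))))

reduction : ℕ → ∀ {n} → (Fin n → Cantor) → Fin n → Cantor
reduction k₀ x p = atLeast lexOps x (cutoff k₀ (toℕ p))

reduction-computable : ∀ k₀ {n} → Computable (reduction k₀ {n})
reduction-computable k₀ {n} =
  dispatchC (λ p → atLeast codeOps {n} (column ∘ toℕ) (cutoff k₀ p)) n ,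
  λ x i j → eval-dispatch (λ p j → b2n (atLeast lexOps x (cutoff k₀ p) j))
              (λ p → atLeast-compatible Computes-compatible (column-computes x) (cutoff k₀ p))
              n j (<⇒≤ (toℕ<n i))

count-reduction : ∀ {α n k₀} {x : Fin n → Cantor} {u u′ : Fin n → Bool} → Proper α →
                  (∀ i → SAlpha α (x i) (u i)) → (∀ p → SAlpha α (reduction k₀ x p) (u′ p)) →
                  count u′ ≡ lowerUpTo k₀ (count u)
count-reduction {n = n} {k₀} {u = u} {u′} proper hu hu′ = begin
  count u′                                        ≡⟨ count-cong outputs ⟩
  count {n} (λ p → cutoff k₀ (toℕ p) ≤ᵇ count u) ≡⟨ count-cutoffs n k₀ (count u) (count≤n u) ⟩
  lowerUpTo k₀ (count u)                          ∎
  where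
  outputs : ∀ p → u′ p ≡ (cutoff k₀ (toℕ p) ≤ᵇ count u)
  outputs p = trans (SAlpha-functional (hu′ p) (atLeast-compatible (SAlpha-compatible proper) hu m))
                    (atLeast-bool u m)
    where m = cutoff k₀ (toℕ p)

mainTheorem15 : (n : ℕ) → 1 ≤ n → (k₀ : ℕ) → 0 < k₀ →
    (w w' : Fin (suc n) → Bool) →
    (∀ (k : Fin (suc n)) → k₀ < toℕ k → w k ≡ w' k) →
    (∀ (j : Fin n) → toℕ (fs j) ≤ k₀ → w (fs j) ≡ w' (inject₁ j)) →
    w fz ≡ w' fz →
    (α : Cantor) → Proper α →
    _≤sW_via_ {n} (H n w) (H n w') α
mainTheorem15 n _ k₀ _ w w′ above shifted at-zero α proper =
  reduction k₀ , reduction-computable k₀ , id , correct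
  where
  correct : ∀ x b b′ → SG α (H n w) x b → SG α (H n w′) (reduction k₀ x) b′ → b ≡ b′
  correct x _ _ (u , hu , refl) (u′ , hu′ , refl) =
    weights-match w w′ above shifted at-zero (t u) (t u′) (begin
      toℕ (t u′)               ≡⟨ toℕ-t u′ ⟩
      count u′                 ≡⟨ count-reduction proper hu hu′ ⟩
      lowerUpTo k₀ (count u)   ≡⟨ cong (lowerUpTo k₀) (toℕ-t u) ⟨
      lowerUpTo k₀ (toℕ (t u)) ∎)
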